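{- Let $m\geq 2$ be an integer. All bridging arcs of $A(2m)$ have the same colour: they are of colour "$\to$" if $m$ is odd and of colour "$\twoheadrightarrow$" if $m$ is even.
   Context: A hyperbinary expansion of a positive integer $n$ is a word $x_1\cdots x_k$ over the alphabet $\{0,1,2\}$ with $x_1\neq 0$ and $n=\sum_{i=1}^k x_i2^{k-i}$; $\mathcal H(n)$ denotes the set of hyperbinary expansions of $n$. Words are regarded up to leading zeros. Single-step reductions are: (I) $2\vec y \to 1\,0\,\vec y$; (II) $\vec x\,0\,2\,\vec y\to \vec x\,1\,0\,\vec y$; (III) $\vec x\,1\,2\,\vec y \twoheadrightarrow \vec x\,2\,0\,\vec y$, for words $\vec x,\vec y$ over $\{0,1,2\}$. If $\vec u$ is transformed into $\vec v$ by one single-step reduction, $\vec v$ is a child of $\vec u$. $A(n)$ is the directed graph with vertex set $\mathcal H(n)$ and an arc from $\vec u$ to $\vec v$ iff $\vec v$ is a child of $\vec u$; arcs from reductions of type I or II are coloured "$\to$", those of type III are coloured "$\twoheadrightarrow$". Let $\phi'(x_1\cdots x_k)=x_1\cdots x_k0$ for $x_1\cdots x_k\in\mathcal H(m)$ and $\phi''(x_1\cdots x_k)=x_1\cdots x_k2$ for $x_1\cdots x_k\in\mathcal H(m-1)$; both map into $\mathcal H(2m)$. A bridging arc of $A(2m)$ is an arc from a node of $\phi''(\mathcal H(m-1))$ to a node of $\phi'(\mathcal H(m))$. -}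

module Defs where

open import Data.Nat using (ℕ; zero; suc; _+_; _*_)
open import Data.List using (List; []; _∷_; _++_; foldl)
open import Data.Product using (Σ; _×_; _,_)
open import Relation.Binary.PropositionalEquality using (_≡_)
open import Relation.Nullary using (¬_)

data Digit : Set where
  d0 d1 d2 : Digit

digitVal : Digit → ℕ
digitVal d0 = 0
digitVal d1 = 1
digitVal d2 = 2

-- a word x₁⋯x_k, most significant digit first
Word : Set
Word = List Digit

value : Word → ℕ
value = foldl (λ acc d → 2 * acc + digitVal d) 0

data LeadingNonZero : Word → Set where
  lead : ∀ {d ws} → ¬ (d ≡ d0) → LeadingNonZero (d ∷ ws)

Hyperbinary : ℕ → Word → Set
Hyperbinary n w = LeadingNonZero w × value w ≡ n

data Colour : Set where
  arrow twoheadarrow : Colour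

data Step : Word → Word → Colour → Set where
  stepI   : ∀ y → Step (d2 ∷ y) (d1 ∷ d0 ∷ y) arrow
  stepII  : ∀ x y → Step (x ++ d0 ∷ d2 ∷ y) (x ++ d1 ∷ d0 ∷ y) arrow
  stepIII : ∀ x y → Step (x ++ d1 ∷ d2 ∷ y) (x ++ d2 ∷ d0 ∷ y) twoheadarrow

Arc : ℕ → Word → Word → Colour → Set
Arc n u v c = Hyperbinary n u × Hyperbinary n v × Step u v c

-- u ∈ φ''(𝓗(m-1))  (here m-1 is passed as k)
InPhi'' : ℕ → Word → Set
InPhi'' k u = Σ Word λ w → Hyperbinary k w × u ≡ w ++ d2 ∷ []

-- v ∈ φ'(𝓗(m))
InPhi' : ℕ → Word → Set
InPhi' m v = Σ Word λ w → Hyperbinary m w × v ≡ w ++ d0 ∷ []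

-- A reduction only rewrites a window of two or three digits followed by an
-- untouched suffix y.  A bridging arc turns a word ending in 2 into one ending
-- in 0, so the suffix must be empty and the window covers the last two digits:
-- the arc is 2 → 10 or 02 → 10 (colour →) or 12 ↠ 20.  Hence the expansion of
-- m that φ' extends ends in 1 in the first case and in 2 in the second, which
-- fixes the parity of m.
module Submission where

open import Defs
open import Data.Nat using (ℕ; _≤_; _%_; _∸_; _*_; _+_)
open import Data.Nat.Properties using (+-comm; *-comm; 0≢1+n; 1+n≢0)
open import Data.Nat.DivMod using ([m+kn]%n≡m%n)
open import Data.Product using (_×_; _,_; Σ)
open import Data.Empty using (⊥-elim)
open import Data.List using (List; []; _∷_; _++_; _∷ʳ_; initLast; _∷ʳ′_)
open import Data.List.Properties using (++-assoc; ++-identityʳ; ∷ʳ-injectiveˡ; ∷ʳ-injectiveʳ; foldl-++)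
open import Relation.Binary.PropositionalEquality
open import Relation.Nullary using (¬_)

open ≡-Reasoning

-- the digit before the final 0 in the target of a bridging arc of this colour
colourDigit : Colour → Digit
colourDigit arrow        = d1
colourDigit twoheadarrow = d2

module _ {a} {A : Set a} where

  common-suffix-empty : ∀ (p q w w′ y : List A) {x x′ : A} → ¬ x ≡ x′ →
    p ++ y ≡ w ∷ʳ x → q ++ y ≡ w′ ∷ʳ x′ → y ≡ []
  common-suffix-empty p q w w′ y x≢x′ p++y≡ q++y≡ with initLast y
  ... | []        = refl
  ... | y′ ∷ʳ′ z  = ⊥-elim (x≢x′ (trans (sym (last-is p w p++y≡)) (last-is q w′ q++y≡)))
    where
    last-is : ∀ r {v} s → r ++ y′ ∷ʳ z ≡ s ∷ʳ v → z ≡ v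
    last-is r s eq = ∷ʳ-injectiveʳ (r ++ y′) s (trans (++-assoc r y′ (z ∷ [])) eq)

  ++-∷-∷-reassoc : ∀ (x : List A) a b y → x ++ a ∷ b ∷ y ≡ ((x ∷ʳ a) ∷ʳ b) ++ y
  ++-∷-∷-reassoc []      a b y = refl
  ++-∷-∷-reassoc (c ∷ x) a b y = cong (c ∷_) (++-∷-∷-reassoc x a b y)

d2≢d0 : ¬ d2 ≡ d0
d2≢d0 ()

window-at-end : ∀ p x a y {w w′} →
  p ++ y ≡ w ∷ʳ d2 → ((x ∷ʳ a) ∷ʳ d0) ++ y ≡ w′ ∷ʳ d0 → w′ ≡ x ∷ʳ a
window-at-end p x a y {w} {w′} u≡ v≡
  with refl ← common-suffix-empty p ((x ∷ʳ a) ∷ʳ d0) w w′ y d2≢d0 u≡ v≡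
  = sym (∷ʳ-injectiveˡ (x ∷ʳ a) w′ (trans (sym (++-identityʳ _)) v≡))

bridging-step : ∀ {u v c w w′} → Step u v c → u ≡ w ∷ʳ d2 → v ≡ w′ ∷ʳ d0 →
  Σ Word λ x → w′ ≡ x ∷ʳ colourDigit c
bridging-step (stepI y) u≡ v≡ = [] , window-at-end (d2 ∷ []) [] d1 y u≡ v≡
bridging-step (stepII x y) u≡ v≡ = x , window-at-end (x ∷ʳ d0 ∷ʳ d2) x d1 y
  (trans (sym (++-∷-∷-reassoc x d0 d2 y)) u≡) (trans (sym (++-∷-∷-reassoc x d1 d0 y)) v≡)
bridging-step (stepIII x y) u≡ v≡ = x , window-at-end (x ∷ʳ d1 ∷ʳ d2) x d2 y
  (trans (sym (++-∷-∷-reassoc x d1 d2 y)) u≡) (trans (sym (++-∷-∷-reassoc x d2 d0 y)) v≡)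

value-∷ʳ : ∀ xs d → value (xs ∷ʳ d) ≡ 2 * value xs + digitVal d
value-∷ʳ xs d = foldl-++ _ 0 xs (d ∷ [])

value-∷ʳ-%2 : ∀ xs d → value (xs ∷ʳ d) % 2 ≡ digitVal d % 2
value-∷ʳ-%2 xs d = begin
  value (xs ∷ʳ d) % 2              ≡⟨ cong (_% 2) (value-∷ʳ xs d) ⟩
  (2 * value xs + digitVal d) % 2  ≡⟨ cong (λ n → (n + digitVal d) % 2) (*-comm 2 (value xs)) ⟩
  (value xs * 2 + digitVal d) % 2  ≡⟨ cong (_% 2) (+-comm (value xs * 2) (digitVal d)) ⟩
  (digitVal d + value xs * 2) % 2  ≡⟨ [m+kn]%n≡m%n (digitVal d) (value xs) 2 ⟩
  digitVal d % 2                   ∎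

colour-of-parity : ∀ {m} c → m % 2 ≡ digitVal (colourDigit c) % 2 →
  (m % 2 ≡ 1 → c ≡ arrow) × (m % 2 ≡ 0 → c ≡ twoheadarrow)
colour-of-parity arrow        odd  = (λ _ → refl) , λ even → ⊥-elim (0≢1+n (trans (sym even) odd))
colour-of-parity twoheadarrow even = (λ odd → ⊥-elim (1+n≢0 (trans (sym odd) even))) , λ _ → refl

proposition3p5 : (m : ℕ) → 2 ≤ m → (u v : Word) (c : Colour) →
    Arc (2 * m) u v c → InPhi'' (m ∸ 1) u → InPhi' m v →
    (m % 2 ≡ 1 → c ≡ arrow) × (m % 2 ≡ 0 → c ≡ twoheadarrow)
proposition3p5 m _ u v c (_ , _ , step) (w , _ , u≡) (w′ , (_ , value-w′) , v≡)
  with x , w′≡ ← bridging-step step u≡ v≡ = colour-of-parity {m} c (begin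
    m % 2                            ≡⟨ cong (_% 2) (sym value-w′) ⟩
    value w′ % 2                     ≡⟨ cong (λ z → value z % 2) w′≡ ⟩
    value (x ∷ʳ colourDigit c) % 2   ≡⟨ value-∷ʳ-%2 x (colourDigit c) ⟩
    digitVal (colourDigit c) % 2     ∎)
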